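{- Let $Y_n$ be $A_n$ or $R_n$, let $1\le k<n$, and let $b=b_{k+1}\ldots b_n$ be an admissible suffix in $Y_n$. If $s$ is the last or the first sequence (with respect to $\prec_c$) among the sequences of $Y_n$ having suffix $b$, then either $s=0\,1\,2\ldots(k-2)(k-1)\,b$ or $s=0\,1\,2\ldots(k-2)\,0\,b$.
   Context: For a sequence $s_1\ldots s_m$, $\mathrm{asc}=\#\{i<m: s_i<s_{i+1}\}$ and $\max=\max_i s_i$. $A_n$ (resp. $R_n$) is the set of sequences $s_1\ldots s_n$ of non-negative integers with $s_1=0$ and $0\le s_{k+1}\le\mathrm{asc}(s_1\ldots s_k)+1$ (resp. $\le\max(s_1\ldots s_k)+1$) for $1\le k<n$. A word $b=b_{k+1}\ldots b_n$ is an admissible suffix in $Y_n$ if some sequence of $Y_n$ ends with $b$. Co-Reflected Gray Code order: $s\prec_c t$ if, with $k$ the rightmost position where $s$ and $t$ differ, either $\sum_{i=k+1}^n s_i+(n-k)$ is even and $s_k>t_k$, or it is odd and $s_k<t_k$. -}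

module Defs where

open import Data.Nat using (ℕ; zero; suc; _+_; _≤_; _<_; _⊔_; _%_; _≟_; _<ᵇ_)
open import Data.Bool using (if_then_else_)
open import Data.List using (List; []; _∷_; length; take; reverse; _++_; upTo)
open import Data.Product using (_×_; Σ; ∃; _,_)
open import Data.Sum using (_⊎_)
open import Data.Empty using (⊥)
open import Relation.Nullary using (yes; no; ¬_)
open import Relation.Binary.PropositionalEquality using (_≡_)

asc : List ℕ → ℕ
asc []            = 0
asc (x ∷ [])      = 0
asc (x ∷ y ∷ xs)  = (if x <ᵇ y then 1 else 0) + asc (y ∷ xs)

-- maximum of s_1 … s_m (0 for the empty word; only used on non-empty prefixes)
maxL : List ℕ → ℕ
maxL []       = 0
maxL (x ∷ xs) = x ⊔ maxL xs

-- the two families: ascent sequences A_n and restricted growth functions R_n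
data Family : Set where
  A R : Family

stat : Family → List ℕ → ℕ
stat A = asc
stat R = maxL

-- 0-indexed lookup: at s i ≡ just the (i+1)-th entry
data Maybe' : Set where
  none : Maybe'
  some : ℕ → Maybe'

at : List ℕ → ℕ → Maybe'
at []       _       = none
at (x ∷ xs) zero    = some x
at (x ∷ xs) (suc i) = at xs i

-- s ∈ Y_n : length n, s_1 = 0, and for 1 ≤ k < n,
-- s_{k+1} ≤ stat(s_1 … s_k) + 1   (s_{k+1} is the entry at 0-index k)
InY : Family → ℕ → List ℕ → Set
InY Y n s =
  (length s ≡ n) ×
  (at s 0 ≡ some 0) ×
  (∀ (k x : ℕ) → 1 ≤ k → at s k ≡ some x → x ≤ stat Y (take k s) + 1)

HasSuffix : List ℕ → List ℕ → Set
HasSuffix s b = ∃ λ p → s ≡ p ++ b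

Admissible : Family → ℕ → List ℕ → Set
Admissible Y n b = ∃ λ s → InY Y n s × HasSuffix s b

-- Co-Reflected Gray code order, computed on the reversed words.
-- acc = (sum of the common suffix after the current position) + (its length),
-- i.e. Σ_{i=k+1}^n s_i + (n - k) once the rightmost difference k is reached.
precRev : List ℕ → List ℕ → ℕ → Set
precRev []       []       acc = ⊥
precRev []       (_ ∷ _)  acc = ⊥
precRev (_ ∷ _)  []       acc = ⊥
precRev (x ∷ xs) (y ∷ ys) acc with x ≟ y
... | yes _ = precRev xs ys (acc + x + 1)
... | no  _ = ((acc % 2 ≡ 0) × (y < x)) ⊎ ((acc % 2 ≡ 1) × (x < y))

_≺c_ : List ℕ → List ℕ → Set
s ≺c t = precRev (reverse s) (reverse t) 0

-- At the rightmost position where two sequences with common suffix d differ, ≺c compares the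
-- two entries in a direction fixed by the parity of Σ (dᵢ + 1). Hence if s is extremal among the
-- sequences of Yₙ with suffix b, then for every longer suffix d of s, all sequences of Yₙ
-- differing from s last at the entry just before d lie on the same side of s. After a staircase
-- 0 1 … k, an entry v ≤ k + 1 may be replaced by k + 1, and by 0 if v ≤ k, without leaving Yₙ,
-- since no later prefix loses ascents or maximum. So that entry is 0 or k + 1, for otherwise s
-- has competitors on both sides. By induction from the left, the prefix of s is a staircase
-- followed by 0 or by its next value; a 0 strictly inside the prefix is excluded in the same
-- way, using parity when it is followed by another 0.

module Submission where

open import Defs
open import Data.Nat using (ℕ; zero; suc; _+_; _≤_; _<_; _∸_; _⊔_; _%_; _≟_; _<ᵇ_; z≤n; s≤s; z<s)
open import Data.Nat.Properties
open import Data.Nat.ListAction using (sum)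
open import Data.Nat.ListAction.Properties using (sum-↭)
open import Data.Bool using (true; false; if_then_else_; T)
open import Data.Unit using (tt)
open import Data.List
  using (List; []; _∷_; _++_; _∷ʳ_; [_]; length; upTo; reverse; take; map; initLast; _∷ʳ′_)
open import Data.List.Properties
  using ( length-++; length-upTo; ++-assoc; ++-identityʳ; ++-cancelʳ; ∷ʳ-injectiveʳ; ∷ʳ-++; upTo-∷ʳ
        ; reverse-++; unfold-reverse; reverse-map)
open import Data.List.Relation.Binary.Permutation.Propositional.Properties using (↭-reverse)
open import Data.Product using (_,_; ∃; proj₁; proj₂)
open import Data.Sum as Sum using (_⊎_; inj₁; inj₂)
open import Data.Empty using (⊥; ⊥-elim)
open import Relation.Nullary using (¬_; yes; no; contradiction)
open import Relation.Binary.PropositionalEquality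
  using (_≡_; _≢_; ≢-sym; refl; sym; trans; cong; cong₂; subst; subst₂; module ≡-Reasoning)

variable
  k ε a u v w x y : ℕ
  L L′ c d s : List ℕ

ascent : ℕ → ℕ → ℕ
ascent x y = if x <ᵇ y then 1 else 0

ascent-< : x < y → ascent x y ≡ 1
ascent-< {x} {y} x<y with x <ᵇ y | <⇒<ᵇ x<y
... | true | _ = refl

ascent-≮ : ¬ x < y → ascent x y ≡ 0
ascent-≮ {x} {y} x≮y with x <ᵇ y in eq
... | false = refl
... | true  = contradiction (<ᵇ⇒< x y (subst T (sym eq) tt)) x≮y

ascent≤1 : ∀ x y → ascent x y ≤ 1
ascent≤1 x y with x <ᵇ y
... | true  = ≤-refl
... | false = z≤n

ascent-antitoneˡ : w ≤ v → ∀ y → ascent v y ≤ ascent w y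
ascent-antitoneˡ {w} {v} w≤v y with v <? y
... | yes v<y = ≤-reflexive (trans (ascent-< v<y) (sym (ascent-< (≤-<-trans w≤v v<y))))
... | no  v≮y = subst (_≤ ascent w y) (sym (ascent-≮ v≮y)) z≤n

asc-∷-antitone : w ≤ v → ∀ m → asc (v ∷ m) ≤ asc (w ∷ m)
asc-∷-antitone w≤v []      = z≤n
asc-∷-antitone w≤v (y ∷ m) = +-monoˡ-≤ (asc (y ∷ m)) (ascent-antitoneˡ w≤v y)

asc-∷-≤-suc : ∀ v w m → asc (v ∷ m) ≤ suc (asc (w ∷ m))
asc-∷-≤-suc v w []      = z≤n
asc-∷-≤-suc v w (y ∷ m) =
  +-mono-≤ (ascent≤1 v y) (m≤n+m (asc (y ∷ m)) (ascent w y))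

asc-++-∷ : ∀ l y m → asc (l ++ y ∷ m) ≡ asc (l ∷ʳ y) + asc (y ∷ m)
asc-++-∷ []            y m = refl
asc-++-∷ (x ∷ [])      y m = cong (_+ asc (y ∷ m)) (sym (+-identityʳ (ascent x y)))
asc-++-∷ (x ∷ x′ ∷ l) y m =
  trans (cong (ascent x x′ +_) (asc-++-∷ (x′ ∷ l) y m)) (sym (+-assoc (ascent x x′) _ _))

asc-upTo-∷ʳ : ∀ k v → asc (upTo (suc k) ∷ʳ v) ≡ k + ascent k v
asc-upTo-∷ʳ zero    v = +-identityʳ (ascent 0 v)
asc-upTo-∷ʳ (suc k) v = begin
  asc (upTo (suc (suc k)) ∷ʳ v)
    ≡⟨ cong (λ l → asc (l ∷ʳ v)) (upTo-∷ʳ (suc k)) ⟨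
  asc ((upTo (suc k) ∷ʳ suc k) ∷ʳ v)
    ≡⟨ cong asc (++-assoc (upTo (suc k)) [ suc k ] [ v ]) ⟩
  asc (upTo (suc k) ++ suc k ∷ [ v ])
    ≡⟨ asc-++-∷ (upTo (suc k)) (suc k) [ v ] ⟩
  asc (upTo (suc k) ∷ʳ suc k) + (ascent (suc k) v + 0)
    ≡⟨ cong₂ _+_ (asc-upTo-∷ʳ k (suc k)) (+-identityʳ _) ⟩
  k + ascent k (suc k) + ascent (suc k) v
    ≡⟨ cong (λ b → k + b + ascent (suc k) v) (ascent-< (n<1+n k)) ⟩
  k + 1 + ascent (suc k) v
    ≡⟨ cong (_+ ascent (suc k) v) (+-comm k 1) ⟩
  suc k + ascent (suc k) v
    ∎
  where open ≡-Reasoning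

asc-upTo : ∀ k → asc (upTo (suc k)) ≡ k
asc-upTo zero    = refl
asc-upTo (suc k) = begin
  asc (upTo (suc (suc k)))      ≡⟨ cong asc (upTo-∷ʳ (suc k)) ⟨
  asc (upTo (suc k) ∷ʳ suc k)   ≡⟨ asc-upTo-∷ʳ k (suc k) ⟩
  k + ascent k (suc k)          ≡⟨ cong (k +_) (ascent-< (n<1+n k)) ⟩
  k + 1                         ≡⟨ +-comm k 1 ⟩
  suc k                         ∎
  where open ≡-Reasoning

asc-upTo-++-∷ : ∀ k v m → asc (upTo (suc k) ++ v ∷ m) ≡ k + (ascent k v + asc (v ∷ m))
asc-upTo-++-∷ k v m = begin
  asc (upTo (suc k) ++ v ∷ m)                ≡⟨ asc-++-∷ (upTo (suc k)) v m ⟩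
  asc (upTo (suc k) ∷ʳ v) + asc (v ∷ m)      ≡⟨ cong (_+ asc (v ∷ m)) (asc-upTo-∷ʳ k v) ⟩
  k + ascent k v + asc (v ∷ m)               ≡⟨ +-assoc k (ascent k v) (asc (v ∷ m)) ⟩
  k + (ascent k v + asc (v ∷ m))             ∎
  where open ≡-Reasoning

asc-lower : v ≤ k → ∀ m → asc (upTo (suc k) ++ v ∷ m) ≤ asc (upTo (suc k) ++ 0 ∷ m)
asc-lower {v} {k} v≤k m = begin
  asc (upTo (suc k) ++ v ∷ m)          ≡⟨ asc-upTo-++-∷ k v m ⟩
  k + (ascent k v + asc (v ∷ m))       ≡⟨ cong (λ b → k + (b + asc (v ∷ m))) (ascent-≮ (≤⇒≯ v≤k)) ⟩
  k + asc (v ∷ m)                      ≤⟨ +-monoʳ-≤ k (asc-∷-antitone z≤n m) ⟩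
  k + asc (0 ∷ m)                      ≡⟨ cong (λ b → k + (b + asc (0 ∷ m))) (ascent-≮ {k} {0} λ ()) ⟨
  k + (ascent k 0 + asc (0 ∷ m))       ≡⟨ asc-upTo-++-∷ k 0 m ⟨
  asc (upTo (suc k) ++ 0 ∷ m)          ∎
  where open ≤-Reasoning

asc-raise : v ≤ suc k → ∀ m → asc (upTo (suc k) ++ v ∷ m) ≤ asc (upTo (suc k) ++ suc k ∷ m)
asc-raise {v} {k} v≤1+k m = begin
  asc (upTo (suc k) ++ v ∷ m)                      ≡⟨ asc-upTo-++-∷ k v m ⟩
  k + (ascent k v + asc (v ∷ m))                   ≤⟨ +-monoʳ-≤ k (last-step v≤1+k) ⟩
  k + (ascent k (suc k) + asc (suc k ∷ m))         ≡⟨ asc-upTo-++-∷ k (suc k) m ⟨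
  asc (upTo (suc k) ++ suc k ∷ m)                  ∎
  where
  open ≤-Reasoning
  last-step : v ≤ suc k → ascent k v + asc (v ∷ m) ≤ ascent k (suc k) + asc (suc k ∷ m)
  last-step v≤1+k with v ≟ suc k
  ... | yes refl = ≤-refl
  ... | no  v≢1+k = begin
    ascent k v + asc (v ∷ m)              ≡⟨ cong (_+ asc (v ∷ m)) (ascent-≮ k≮v) ⟩
    asc (v ∷ m)                           ≤⟨ asc-∷-≤-suc v (suc k) m ⟩
    1 + asc (suc k ∷ m)                   ≡⟨ cong (_+ asc (suc k ∷ m)) (ascent-< (n<1+n k)) ⟨
    ascent k (suc k) + asc (suc k ∷ m)    ∎
    where
    k≮v : ¬ k < v
    k≮v k<v = v≢1+k (≤-antisym v≤1+k k<v)

maxL-++ : ∀ l m → maxL (l ++ m) ≡ maxL l ⊔ maxL m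
maxL-++ []      m = refl
maxL-++ (x ∷ l) m = trans (cong (x ⊔_) (maxL-++ l m)) (sym (⊔-assoc x (maxL l) (maxL m)))

maxL-upTo : ∀ k → maxL (upTo (suc k)) ≡ k
maxL-upTo zero    = refl
maxL-upTo (suc k) = begin
  maxL (upTo (suc (suc k)))         ≡⟨ cong maxL (upTo-∷ʳ (suc k)) ⟨
  maxL (upTo (suc k) ∷ʳ suc k)      ≡⟨ maxL-++ (upTo (suc k)) [ suc k ] ⟩
  maxL (upTo (suc k)) ⊔ (suc k ⊔ 0) ≡⟨ cong₂ _⊔_ (maxL-upTo k) (⊔-identityʳ (suc k)) ⟩
  k ⊔ suc k                         ≡⟨ m≤n⇒m⊔n≡n (n≤1+n k) ⟩
  suc k                             ∎
  where open ≡-Reasoning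

maxL-lower : v ≤ k → ∀ m → maxL (upTo (suc k) ++ v ∷ m) ≤ maxL (upTo (suc k) ++ 0 ∷ m)
maxL-lower {v} {k} v≤k m
  rewrite maxL-++ (upTo (suc k)) (v ∷ m) | maxL-++ (upTo (suc k)) (0 ∷ m) | maxL-upTo k
  = ⊔-lub (m≤m⊔n k (maxL m)) (⊔-lub (≤-trans v≤k (m≤m⊔n k (maxL m))) (m≤n⊔m k (maxL m)))

maxL-raise : v ≤ suc k → ∀ m → maxL (upTo (suc k) ++ v ∷ m) ≤ maxL (upTo (suc k) ++ suc k ∷ m)
maxL-raise {v} {k} v≤1+k m
  rewrite maxL-++ (upTo (suc k)) (v ∷ m) | maxL-++ (upTo (suc k)) (suc k ∷ m)
  = ⊔-monoʳ-≤ (maxL (upTo (suc k))) (⊔-monoˡ-≤ (maxL m) v≤1+k)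

stat-upTo : ∀ Y k → stat Y (upTo (suc k)) ≡ k
stat-upTo A = asc-upTo
stat-upTo R = maxL-upTo

stat-upTo-∷ʳ-0 : ∀ Y k → stat Y (upTo (suc k) ∷ʳ 0) ≡ k
stat-upTo-∷ʳ-0 A k = trans (asc-upTo-∷ʳ k 0) (trans (cong (k +_) (ascent-≮ {k} {0} λ ())) (+-identityʳ k))
stat-upTo-∷ʳ-0 R k = trans (maxL-++ (upTo (suc k)) [ 0 ]) (trans (cong (_⊔ 0) (maxL-upTo k)) (⊔-identityʳ k))

stat-lower : ∀ Y → v ≤ k → ∀ m →
  stat Y (upTo (suc k) ++ v ∷ m) ≤ stat Y (upTo (suc k) ++ 0 ∷ m)
stat-lower A = asc-lower
stat-lower R = maxL-lower

stat-raise : ∀ Y → v ≤ suc k → ∀ m →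
  stat Y (upTo (suc k) ++ v ∷ m) ≤ stat Y (upTo (suc k) ++ suc k ∷ m)
stat-raise A = asc-raise
stat-raise R = maxL-raise

at-++ˡ : ∀ (L d : List ℕ) → k < length L → at (L ++ d) k ≡ at L k
at-++ˡ {zero}  (x ∷ L) d _         = refl
at-++ˡ {suc k} (x ∷ L) d (s≤s k<L) = at-++ˡ L d k<L

at-++ʳ : ∀ (L d : List ℕ) j → at (L ++ d) (length L + j) ≡ at d j
at-++ʳ []      d j = refl
at-++ʳ (x ∷ L) d j = at-++ʳ L d j

take-++ˡ : ∀ (L d : List ℕ) → k ≤ length L → take k (L ++ d) ≡ take k L
take-++ˡ {zero}  L       d _         = refl
take-++ˡ {suc k} (x ∷ L) d (s≤s k≤L) = cong (x ∷_) (take-++ˡ L d k≤L)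

take-++ʳ : ∀ (L d : List ℕ) j → take (length L + j) (L ++ d) ≡ L ++ take j d
take-++ʳ []      d j = refl
take-++ʳ (x ∷ L) d j = cong (x ∷_) (take-++ʳ L d j)

odd⇒suc-even : a % 2 ≡ 1 → suc a % 2 ≡ 0
odd⇒suc-even {suc zero}    _ = refl
odd⇒suc-even {suc (suc a)} p = odd⇒suc-even {a} p

even⇒suc-odd : a % 2 ≡ 0 → suc a % 2 ≡ 1
even⇒suc-odd {zero}        _ = refl
even⇒suc-odd {suc (suc a)} p = even⇒suc-odd {a} p

-- Verdict of ≺c at the rightmost difference, x in the first sequence and y in the second,
-- when the common suffix has weight a.
data Before (a x y : ℕ) : Set where
  even-down : a % 2 ≡ 0 → y < x → Before a x y
  odd-up    : a % 2 ≡ 1 → x < y → Before a x y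

Before-flip : Before a y x → Before (suc a) x y
Before-flip {a} (even-down even x<y) = odd-up (even⇒suc-odd {a} even) x<y
Before-flip {a} (odd-up odd y<x)     = even-down (odd⇒suc-even {a} odd) y<x

Before-down⇒even : Before a x y → y < x → a % 2 ≡ 0
Before-down⇒even (even-down even _) _   = even
Before-down⇒even (odd-up _ x<y)     y<x = contradiction x<y (<-asym y<x)

Before-up⇒odd : Before a x y → x < y → a % 2 ≡ 1
Before-up⇒odd (even-down _ y<x) x<y = contradiction y<x (<-asym x<y)
Before-up⇒odd (odd-up odd _)    _   = odd

-- The paper's Σ_{i>k} s_i + (n − k) for the common suffix s_{k+1} … s_n.
weight : List ℕ → ℕ
weight d = sum (map suc d)

weight-reverse : ∀ d → weight (reverse d) ≡ weight d
weight-reverse d = trans (cong sum (reverse-map suc d)) (sum-↭ (↭-reverse (map suc d)))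

precRev-≢ : ∀ {xs ys} → x ≢ y → precRev (x ∷ xs) (y ∷ ys) a → Before a x y
precRev-≢ {x} {y} x≢y p with x ≟ y
... | yes x≡y = contradiction x≡y x≢y
... | no  _ with p
...   | inj₁ (even , y<x) = even-down even y<x
...   | inj₂ (odd  , x<y) = odd-up odd x<y

precRev-++ : ∀ r {xs ys} a → x ≢ y → precRev (r ++ x ∷ xs) (r ++ y ∷ ys) a → Before (a + weight r) x y
precRev-++ {x} {y} [] a x≢y p = subst (λ b → Before b x y) (sym (+-identityʳ a)) (precRev-≢ x≢y p)
precRev-++ {x} {y} (z ∷ r) a x≢y p with z ≟ z
... | no  z≢z = contradiction refl z≢z
... | yes _   = subst (λ b → Before b x y) weight-step (precRev-++ r (a + z + 1) x≢y p)
  where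
  weight-step : a + z + 1 + weight r ≡ a + weight (z ∷ r)
  weight-step = begin
    a + z + 1 + weight r      ≡⟨ +-assoc (a + z) 1 (weight r) ⟩
    a + z + suc (weight r)    ≡⟨ +-assoc a z (suc (weight r)) ⟩
    a + (z + suc (weight r))  ≡⟨ cong (a +_) (+-suc z (weight r)) ⟩
    a + weight (z ∷ r)        ∎
    where open ≡-Reasoning

reverse-++-∷ : ∀ (L : List ℕ) x d → reverse (L ++ x ∷ d) ≡ reverse d ++ x ∷ reverse L
reverse-++-∷ L x d = begin
  reverse (L ++ x ∷ d)              ≡⟨ reverse-++ L (x ∷ d) ⟩
  reverse (x ∷ d) ++ reverse L      ≡⟨ cong (_++ reverse L) (unfold-reverse x d) ⟩
  (reverse d ∷ʳ x) ++ reverse L     ≡⟨ ∷ʳ-++ (reverse d) x (reverse L) ⟩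
  reverse d ++ x ∷ reverse L        ∎
  where open ≡-Reasoning

≺c-at : x ≢ y → (L ++ x ∷ d) ≺c (L′ ++ y ∷ d) → Before (weight d) x y
≺c-at {x} {y} {L} {d} {L′} x≢y p =
  subst (λ b → Before b x y) (weight-reverse d)
    (precRev-++ (reverse d) 0 x≢y
      (subst₂ (λ xs ys → precRev xs ys 0) (reverse-++-∷ L x d) (reverse-++-∷ L′ y d) p))

++-∷-injectiveˡ : (L ++ x ∷ d) ≡ (L′ ++ y ∷ d) → x ≡ y
++-∷-injectiveˡ {L} {x} {d} {L′} {y} eq =
  ∷ʳ-injectiveʳ L L′ (++-cancelʳ d (L ∷ʳ x) (L′ ∷ʳ y)
    (trans (∷ʳ-++ L x d) (trans eq (sym (∷ʳ-++ L′ y d)))))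

HasSuffix-trans : HasSuffix s d → HasSuffix d c → HasSuffix s c
HasSuffix-trans {c = c} (p , refl) (q , refl) = p ++ q , sym (++-assoc p q c)

upTo-++-∷ : ∀ k d → upTo k ++ k ∷ d ≡ upTo (suc k) ++ d
upTo-++-∷ k d = trans (sym (∷ʳ-++ (upTo k) k d)) (cong (_++ d) (upTo-∷ʳ k))

competitor-suffix : ∀ L′ → HasSuffix d c → HasSuffix (L′ ++ y ∷ d) c
competitor-suffix {y = y} L′ d⊒c = HasSuffix-trans (L′ , refl) (HasSuffix-trans ([ y ] , refl) d⊒c)

competitor-≢ : s ≡ L ++ x ∷ d → x ≢ y → ¬ (L′ ++ y ∷ d ≡ s)
competitor-≢ s≡ x≢y t≡s = x≢y (sym (++-∷-injectiveˡ (trans t≡s s≡)))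

upTo-suc-nonempty : ∀ k → 0 < length (upTo (suc k))
upTo-suc-nonempty k = subst (0 <_) (sym (length-upTo (suc k))) z<s

suc≤stat-upTo+1 : ∀ Y k → suc k ≤ stat Y (upTo (suc k)) + 1
suc≤stat-upTo+1 Y k = subst (λ b → suc k ≤ b + 1) (sym (stat-upTo Y k)) (≤-reflexive (+-comm 1 k))

module _ (Y : Family) (n : ℕ) where

  InY-entry≤ : ∀ (L : List ℕ) → 0 < length L → InY Y n (L ++ v ∷ c) → v ≤ stat Y L + 1
  InY-entry≤ {v} {c} L L⁺ (_ , _ , bound) =
    subst (λ p → v ≤ stat Y p + 1) (trans (take-++ʳ L (v ∷ c) 0) (++-identityʳ L))
      (bound (length L + 0) v (≤-trans L⁺ (m≤m+n (length L) 0)) (at-++ʳ L (v ∷ c) 0))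

  InY-replace : ∀ (L : List ℕ) → 0 < length L → w ≤ stat Y L + 1 →
    (∀ m → stat Y (L ++ v ∷ m) ≤ stat Y (L ++ w ∷ m)) →
    InY Y n (L ++ v ∷ c) → InY Y n (L ++ w ∷ c)
  InY-replace {w} {v} {c} L L⁺ w≤ mono (len , s₁≡0 , bound) = len′ , s₁≡0′ , bound′
    where
    len′ : length (L ++ w ∷ c) ≡ n
    len′ = trans (length-++ L) (trans (sym (length-++ L)) len)

    same-prefix : ∀ {k} → k < length L → at (L ++ w ∷ c) k ≡ at (L ++ v ∷ c) k
    same-prefix k<L = trans (at-++ˡ L (w ∷ c) k<L) (sym (at-++ˡ L (v ∷ c) k<L))

    s₁≡0′ : at (L ++ w ∷ c) 0 ≡ some 0
    s₁≡0′ = trans (same-prefix L⁺) s₁≡0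

    suffix-bound : ∀ j x → at (w ∷ c) j ≡ some x → x ≤ stat Y (L ++ take j (w ∷ c)) + 1
    suffix-bound zero    x refl = subst (λ p → x ≤ stat Y p + 1) (sym (++-identityʳ L)) w≤
    suffix-bound (suc j) x eq   = ≤-trans old-bound (+-monoˡ-≤ 1 (mono (take j c)))
      where
      old-bound : x ≤ stat Y (L ++ v ∷ take j c) + 1
      old-bound = subst (λ p → x ≤ stat Y p + 1) (take-++ʳ L (v ∷ c) (suc j))
        (bound (length L + suc j) x (≤-trans L⁺ (m≤m+n (length L) (suc j)))
          (trans (at-++ʳ L (v ∷ c) (suc j)) eq))

    bound′ : ∀ k x → 1 ≤ k → at (L ++ w ∷ c) k ≡ some x → x ≤ stat Y (take k (L ++ w ∷ c)) + 1
    bound′ k x 1≤k eq with <-≤-connex k (length L)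
    ... | inj₁ k<L =
      subst (λ p → x ≤ stat Y p + 1) same-take (bound k x 1≤k (trans (sym (same-prefix k<L)) eq))
      where
      same-take : take k (L ++ v ∷ c) ≡ take k (L ++ w ∷ c)
      same-take = trans (take-++ˡ L (v ∷ c) (<⇒≤ k<L)) (sym (take-++ˡ L (w ∷ c) (<⇒≤ k<L)))
    ... | inj₂ L≤k with m≤n⇒∃[o]m+o≡n L≤k
    ... | j , refl = subst (λ p → x ≤ stat Y p + 1) (sym (take-++ʳ L (w ∷ c) j))
                       (suffix-bound j x (trans (sym (at-++ʳ L (w ∷ c) j)) eq))

  InY-lower : v ≤ k → InY Y n (upTo (suc k) ++ v ∷ c) → InY Y n (upTo (suc k) ++ 0 ∷ c)
  InY-lower {k = k} v≤k =
    InY-replace (upTo (suc k)) (upTo-suc-nonempty k) z≤n (stat-lower Y v≤k)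

  InY-raise : v ≤ suc k → InY Y n (upTo (suc k) ++ v ∷ c) → InY Y n (upTo (suc k) ++ suc k ∷ c)
  InY-raise {k = k} v≤1+k =
    InY-replace (upTo (suc k)) (upTo-suc-nonempty k) (suc≤stat-upTo+1 Y k) (stat-raise Y v≤1+k)

  InY-upTo-entry≤ : InY Y n (upTo (suc k) ++ v ∷ c) → v ≤ suc k
  InY-upTo-entry≤ {k} {v} s∈Y =
    subst (λ b → v ≤ b) (trans (cong (_+ 1) (stat-upTo Y k)) (+-comm k 1))
      (InY-entry≤ (upTo (suc k)) (upTo-suc-nonempty k) s∈Y)

  InY-dip-entry≤ : InY Y n (upTo (suc k) ++ 0 ∷ v ∷ c) → v ≤ suc k
  InY-dip-entry≤ {k} {v} {c} s∈Y =
    subst (λ b → v ≤ b) (trans (cong (_+ 1) (stat-upTo-∷ʳ-0 Y k)) (+-comm k 1))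
      (InY-entry≤ (upTo (suc k) ∷ʳ 0) (subst (0 <_) (sym (length-++ (upTo (suc k)))) z<s)
        (subst (InY Y n) (sym (∷ʳ-++ (upTo (suc k)) 0 (v ∷ c))) s∈Y))

  InY-fill-dip : InY Y n (upTo (suc k) ++ 0 ∷ d) → InY Y n (upTo (suc (suc k)) ++ d)
  InY-fill-dip {k} {d} s∈Y = subst (InY Y n) (upTo-++-∷ (suc k) d) (InY-raise z≤n s∈Y)

  Extremal : List ℕ → List ℕ → Set
  Extremal c s = (∀ t → InY Y n t → HasSuffix t c → ¬ (t ≡ s) → t ≺c s)
               ⊎ (∀ t → InY Y n t → HasSuffix t c → ¬ (t ≡ s) → s ≺c t)

  -- ε = 0 when s is first and ε = 1 when s is last: a last element behaves like a first one
  -- with the parity shifted (Before-flip).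
  record Phase (ε : ℕ) (c s : List ℕ) : Set where
    field
      before : ∀ L L′ {x y d} → HasSuffix d c → s ≡ L ++ x ∷ d → InY Y n (L′ ++ y ∷ d) → x ≢ y →
               Before (ε + weight d) x y
  open Phase

  extremal⇒phase : Extremal c s → ∃ λ ε → Phase ε c s
  extremal⇒phase (inj₁ last)  = 1 , record { before = λ L L′ {_} {y} {d} d⊒c s≡ t∈Y x≢y →
    Before-flip {weight d} (≺c-at {L = L′} {d = d} {L′ = L} (≢-sym x≢y)
      (subst ((L′ ++ y ∷ d) ≺c_) s≡
        (last _ t∈Y (competitor-suffix L′ d⊒c) (competitor-≢ s≡ x≢y)))) }
  extremal⇒phase (inj₂ first) = 0 , record { before = λ L L′ {_} {y} {d} d⊒c s≡ t∈Y x≢y →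
    ≺c-at {L = L} {d = d} {L′ = L′} x≢y
      (subst (_≺c (L′ ++ y ∷ d)) s≡
        (first _ t∈Y (competitor-suffix L′ d⊒c) (competitor-≢ s≡ x≢y))) }

  Phase-∷ : Phase ε c s → Phase ε (v ∷ c) s
  before (Phase-∷ {v = v} phase) L L′ d⊒v∷c = before phase L L′ (HasSuffix-trans d⊒v∷c ([ v ] , refl))

  Phase-no-straddle : Phase ε c s → ∀ (L L₀ L₁ : List ℕ) → s ≡ L ++ v ∷ c →
    InY Y n (L₀ ++ u ∷ c) → InY Y n (L₁ ++ w ∷ c) → u < v → v < w → ⊥
  Phase-no-straddle {ε} {c} phase L L₀ L₁ s≡ t₀∈Y t₁∈Y u<v v<w =
    contradiction (trans (sym even) odd) λ ()
    where
    even : (ε + weight c) % 2 ≡ 0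
    even = Before-down⇒even (before phase L L₀ ([] , refl) s≡ t₀∈Y (>⇒≢ u<v)) u<v
    odd : (ε + weight c) % 2 ≡ 1
    odd = Before-up⇒odd (before phase L L₁ ([] , refl) s≡ t₁∈Y (<⇒≢ v<w)) v<w

  upTo-last-entry : Phase ε c s → InY Y n s → s ≡ upTo (suc k) ++ v ∷ c → v ≡ 0 ⊎ v ≡ suc k
  upTo-last-entry {c = c} {k = k} {v} phase s∈Y s≡ with v ≟ 0 | v ≟ suc k
  ... | yes v≡0 | _          = inj₁ v≡0
  ... | no  _   | yes v≡1+k  = inj₂ v≡1+k
  ... | no  v≢0 | no  v≢1+k  = ⊥-elim
    (Phase-no-straddle phase (upTo (suc k)) (upTo (suc k)) (upTo (suc k)) s≡
      (InY-lower (≤-pred v<1+k) staircase∈Y) (InY-raise v≤1+k staircase∈Y) (n≢0⇒n>0 v≢0) v<1+k)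
    where
    staircase∈Y : InY Y n (upTo (suc k) ++ v ∷ c)
    staircase∈Y = subst (InY Y n) s≡ s∈Y
    v≤1+k = InY-upTo-entry≤ staircase∈Y
    v<1+k = ≤∧≢⇒< v≤1+k v≢1+k

  no-dip : Phase ε c s → InY Y n s → s ≡ upTo (suc k) ++ 0 ∷ v ∷ c → ⊥
  no-dip {ε} {c} {k = k} {v} phase s∈Y refl with v ≟ 0
  ... | no v≢0 =
    Phase-no-straddle phase (upTo (suc k) ∷ʳ 0) (upTo (suc (suc k))) (upTo (suc (suc k)))
      (sym (∷ʳ-++ (upTo (suc k)) 0 (v ∷ c)))
      (InY-lower v≤1+k (InY-fill-dip s∈Y)) (InY-raise (m≤n⇒m≤1+n v≤1+k) (InY-fill-dip s∈Y))
      (n≢0⇒n>0 v≢0) (s≤s v≤1+k)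
    where
    v≤1+k = InY-dip-entry≤ s∈Y
  -- Raising either zero gives a competitor above s; the common suffixes 0 ∷ c and c have weights
  -- of opposite parity, so the two competitors lie on opposite sides of s.
  ... | yes refl = contradiction (trans (sym (odd⇒suc-even {ε + weight c} odd)) odd′) λ ()
    where
    second-raised : InY Y n (upTo (suc (suc k)) ++ suc (suc k) ∷ c)
    second-raised = InY-raise {k = suc k} z≤n (InY-fill-dip {k} s∈Y)
    first-raised : InY Y n (upTo (suc k) ++ suc k ∷ 0 ∷ c)
    first-raised = InY-raise {k = k} z≤n s∈Y
    odd : (ε + weight c) % 2 ≡ 1
    odd = Before-up⇒odd (before phase (upTo (suc k) ∷ʳ 0) (upTo (suc (suc k))) ([] , refl)
            (sym (∷ʳ-++ (upTo (suc k)) 0 (0 ∷ c))) second-raised λ ()) z<s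
    odd′ : suc (ε + weight c) % 2 ≡ 1
    odd′ = subst (λ b → b % 2 ≡ 1) (+-suc ε (weight c))
             (Before-up⇒odd (before phase (upTo (suc k)) (upTo (suc k)) ([ 0 ] , refl) refl
                                 first-raised λ ()) z<s)

  staircase : ∀ j (p : List ℕ) → Phase ε c s → InY Y n s → s ≡ p ++ c → length p ≡ suc j →
    p ≡ upTo j ∷ʳ j ⊎ p ≡ upTo j ∷ʳ 0
  staircase zero    (x ∷ []) phase (_ , refl , _) refl refl = inj₁ refl
  staircase (suc j) p        phase s∈Y s≡ |p| with initLast p
  ... | [] = contradiction |p| λ ()
  ... | p′ ∷ʳ′ v =
    Sum.map (cong₂ _∷ʳ_ p′≡) (cong₂ _∷ʳ_ p′≡) (Sum.swap (upTo-last-entry phase s∈Y s≡staircase))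
    where
    s≡′ = trans s≡ (∷ʳ-++ p′ v _)
    |p′| : length p′ ≡ suc j
    |p′| = suc-injective (trans (+-comm 1 (length p′)) (trans (sym (length-++ p′)) |p|))
    prefix-full : ∀ i → p′ ≡ upTo i ∷ʳ i ⊎ p′ ≡ upTo i ∷ʳ 0 → p′ ≡ upTo (suc i)
    prefix-full i       (inj₁ p′≡) = trans p′≡ (upTo-∷ʳ i)
    prefix-full zero    (inj₂ p′≡) = p′≡
    prefix-full (suc h) (inj₂ p′≡) =
      ⊥-elim (no-dip phase s∈Y
        (trans s≡′ (trans (cong (_++ v ∷ _) p′≡) (∷ʳ-++ (upTo (suc h)) 0 (v ∷ _)))))
    p′≡ = prefix-full j (staircase j p′ (Phase-∷ phase) s∈Y s≡′ |p′|)
    s≡staircase = trans s≡′ (cong (_++ v ∷ _) p′≡)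

prefix-length : ∀ (p b : List ℕ) {n k} →
  length (p ++ b) ≡ n → length b ≡ n ∸ k → k ≤ n → length p ≡ k
prefix-length p b {n} {k} |p++b| |b| k≤n = +-cancelʳ-≡ (n ∸ k) (length p) k (begin
  length p + (n ∸ k)      ≡⟨ cong (length p +_) |b| ⟨
  length p + length b     ≡⟨ length-++ p ⟨
  length (p ++ b)         ≡⟨ |p++b| ⟩
  n                       ≡⟨ m+[n∸m]≡n k≤n ⟨
  k + (n ∸ k)             ∎)
  where open ≡-Reasoning

proposition13 : (Y : Family) (n k : ℕ) (b : List ℕ) (s : List ℕ) →
    1 ≤ k → k < n → length b ≡ n ∸ k → Admissible Y n b →
    InY Y n s → HasSuffix s b →
    ((∀ t → InY Y n t → HasSuffix t b → ¬ (t ≡ s) → t ≺c s)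
    ⊎ (∀ t → InY Y n t → HasSuffix t b → ¬ (t ≡ s) → s ≺c t)) →
    (s ≡ upTo (k ∸ 1) ++ ((k ∸ 1) ∷ b)) ⊎ (s ≡ upTo (k ∸ 1) ++ (0 ∷ b))
proposition13 Y n (suc j) b s (s≤s z≤n) j<n |b| _ s∈Y (p , s≡p++b) extremal =
  Sum.map (extend j) (extend 0) (staircase Y n j p phase s∈Y s≡p++b |p|)
  where
  phase = proj₂ (extremal⇒phase Y n extremal)
  |p| = prefix-length p b (trans (cong length (sym s≡p++b)) (proj₁ s∈Y)) |b| (<⇒≤ j<n)
  extend : ∀ v → p ≡ upTo j ∷ʳ v → s ≡ upTo j ++ v ∷ b
  extend v p≡ = trans s≡p++b (trans (cong (_++ b) p≡) (∷ʳ-++ (upTo j) v b))
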